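{- Let $x\in{^{co}\mathbf{I}}$. Then there exists a total function $G$ from $\mathbb{N}$ to finite lists of signed digits such that for every $p\in\mathbb{Z}^+$ and every $n\ge p$, $|x-\mathtt{Sum}(G(n))|\le 2^{ -p}$ (i.e. $n\mapsto\mathtt{Sum}(G(n))$ converges to $x$ with modulus the canonical inclusion $\mathbb{Z}^+\to\mathbb{N}$).
   Context: Constructive setting. $\mathbf{Sd}=\{ -1,0,1\}$. ${^{co}\mathbf{I}}$ is the greatest fixed point of $\Phi(X)=\{x \mid \exists_{d\in\mathbf{Sd}}\exists_{x'}(x'\in X\wedge |x'|\le 1\wedge x=\frac{d+x'}{2})\}$ (so ${^{co}\mathbf{I}}\subseteq\Phi({^{co}\mathbf{I}})$, and any $X\subseteq\Phi({^{co}\mathbf{I}}\cup X)$ satisfies $X\subseteq{^{co}\mathbf{I}}$). For a finite list $l=(l_1,\dots,l_k)$ of elements of $\mathbf{Sd}$, $\mathtt{Sum}(l):=\sum_{i=1}^{k}l_i2^{ -i}$ (with $\mathtt{Sum}$ of the empty list equal to $0$). -}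

module Defs where

open import Level using (Level; _⊔_) renaming (suc to lsuc)
open import Data.Nat using (ℕ; zero; suc)
open import Data.List using (List; []; _∷_)
open import Data.Product using (_×_)
open import Relation.Binary.Core using (Rel)
open import Relation.Binary.Structures using (IsPartialOrder)
open import Algebra.Bundles using (CommutativeRing)

-- Abstract (constructive) real numbers: a commutative ring with a partial
-- order compatible with the ring operations, in which 2 is invertible
-- (the element ½ with ½ + ½ ≈ 1).  ℝ is an instance; no totality/decidability
-- of ≤ is assumed (constructive setting).
record OrderedRingWithHalf (c ℓ₁ ℓ₂ : Level) : Set (lsuc (c ⊔ ℓ₁ ⊔ ℓ₂)) where
  infix 4 _≤_
  field
    commutativeRing : CommutativeRing c ℓ₁
  open CommutativeRing commutativeRing public
  field
    _≤_            : Rel Carrier ℓ₂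
    ≤-isPartialOrder : IsPartialOrder _≈_ _≤_
    +-monoˡ-≤      : ∀ z {x y} → x ≤ y → x + z ≤ y + z
    *-nonneg       : ∀ {x y} → 0# ≤ x → 0# ≤ y → 0# ≤ x * y
    ½              : Carrier
    ½+½≈1          : ½ + ½ ≈ 1#
    0≤½            : 0# ≤ ½

data Sd : Set where
  m1 d0 p1 : Sd

module _ {c ℓ₁ ℓ₂ : Level} (R : OrderedRingWithHalf c ℓ₁ ℓ₂) where
  open OrderedRingWithHalf R

  AbsLe : Carrier → Carrier → Set ℓ₂
  AbsLe y e = (- e ≤ y) × (y ≤ e)

  half^ : ℕ → Carrier
  half^ zero    = 1#
  half^ (suc n) = ½ * half^ n

  ⟦_⟧ : Sd → Carrier
  ⟦ m1 ⟧ = - 1#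
  ⟦ d0 ⟧ = 0#
  ⟦ p1 ⟧ = 1#

  SumFrom : ℕ → List Sd → Carrier
  SumFrom i []      = 0#
  SumFrom i (d ∷ l) = ⟦ d ⟧ * half^ i + SumFrom (suc i) l

  Sum : List Sd → Carrier
  Sum = SumFrom 1

  -- coI : greatest fixed point of Φ(X) = {x | ∃d∈Sd ∃x' (x'∈X ∧ |x'|≤1 ∧ x = (d+x')/2)}
  record coI (x : Carrier) : Set (c ⊔ ℓ₁ ⊔ ℓ₂) where
    coinductive
    field
      digit : Sd
      tail  : Carrier
      tail-bound : AbsLe tail 1#
      eqn   : x ≈ ½ * (⟦ digit ⟧ + tail)
      tail-coI : coI tail

-- Reading off the first n digits of a coI-representation of x leaves the
-- remainder x − Sum(first n digits) = 2⁻ⁿ · t, where t is the n-th tail of the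
-- representation; every tail satisfies |t| ≤ 1, so the error is at most
-- 2⁻ⁿ ≤ 2⁻ᵖ once n ≥ p.
module Submission where

open import Defs
open import Level using (Level)
open import Data.Nat as ℕ using (ℕ; zero; suc)
open import Data.Nat.Properties using (≤⇒≤′)
open import Data.List using (List; []; _∷_)
open import Data.Product using (Σ; _,_)
import Algebra.Properties.Ring as RingProperties
import Algebra.Solver.Ring.NaturalCoefficients.Default as NaturalSolver
import Relation.Binary.Reasoning.Setoid as SetoidReasoning

module OrderedRingProperties {c ℓ₁ ℓ₂ : Level} (R : OrderedRingWithHalf c ℓ₁ ℓ₂) where
  open OrderedRingWithHalf R
  open RingProperties ring using (x[y-z]≈xy-xz; -‿distribʳ-*; -‿involutive)
  open SetoidReasoning setoid
  open import Relation.Binary.Structures _≈_ using (module IsPartialOrder)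
  open IsPartialOrder ≤-isPartialOrder using () renaming (refl to ≤-refl; trans to ≤-trans; reflexive to ≤-reflexive)

  ≤-resp-≈ : ∀ {x x′ y′ y} → x ≈ x′ → x′ ≤ y′ → y′ ≈ y → x ≤ y
  ≤-resp-≈ x≈x′ x′≤y′ y′≈y = ≤-trans (≤-reflexive x≈x′) (≤-trans x′≤y′ (≤-reflexive y′≈y))

  x≤y⇒0≤y-x : ∀ {x y} → x ≤ y → 0# ≤ y - x
  x≤y⇒0≤y-x {x} x≤y = ≤-resp-≈ (sym (-‿inverseʳ x)) (+-monoˡ-≤ (- x) x≤y) refl

  0≤y-x⇒x≤y : ∀ {x y} → 0# ≤ y - x → x ≤ y
  0≤y-x⇒x≤y {x} {y} 0≤y-x = ≤-resp-≈ (sym (+-identityˡ x)) (+-monoˡ-≤ x 0≤y-x) (begin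
    y - x + x     ≈⟨ +-assoc y (- x) x ⟩
    y + (- x + x) ≈⟨ +-congˡ (-‿inverseˡ x) ⟩
    y + 0#        ≈⟨ +-identityʳ y ⟩
    y             ∎)

  neg-antimono-≤ : ∀ {x y} → x ≤ y → - y ≤ - x
  neg-antimono-≤ {x} {y} x≤y = 0≤y-x⇒x≤y
    (≤-resp-≈ refl (x≤y⇒0≤y-x x≤y) (trans (+-comm y (- x)) (+-congˡ (sym (-‿involutive y)))))

  0≤1 : 0# ≤ 1#
  0≤1 = ≤-trans (≤-resp-≈ (sym (+-identityʳ 0#)) (+-monoˡ-≤ 0# 0≤½) (+-comm ½ 0#))
                (≤-resp-≈ refl (+-monoˡ-≤ ½ 0≤½) ½+½≈1)

  half^-nonneg : ∀ n → 0# ≤ half^ R n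
  half^-nonneg zero    = 0≤1
  half^-nonneg (suc n) = *-nonneg 0≤½ (half^-nonneg n)

  half^-suc-≤ : ∀ n → half^ R (suc n) ≤ half^ R n
  half^-suc-≤ n = 0≤y-x⇒x≤y (≤-resp-≈ refl (half^-nonneg (suc n)) (sym (begin
    h - ½ * h                ≈⟨ +-congʳ (trans (sym (*-identityˡ h)) (*-congʳ (sym ½+½≈1))) ⟩
    (½ + ½) * h - ½ * h      ≈⟨ +-congʳ (distribʳ h ½ ½) ⟩
    ½ * h + ½ * h - ½ * h    ≈⟨ +-assoc (½ * h) (½ * h) (- (½ * h)) ⟩
    ½ * h + (½ * h - ½ * h)  ≈⟨ +-congˡ (-‿inverseʳ (½ * h)) ⟩
    ½ * h + 0#               ≈⟨ +-identityʳ (½ * h) ⟩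
    ½ * h                    ∎)))
    where h = half^ R n

  half^-antitone : ∀ {p n} → p ℕ.≤ n → half^ R n ≤ half^ R p
  half^-antitone p≤n = go (≤⇒≤′ p≤n)
    where
    go : ∀ {p n} → p ℕ.≤′ n → half^ R n ≤ half^ R p
    go ℕ.≤′-refl                  = ≤-refl
    go {n = suc n} (ℕ.≤′-step p≤′n) = ≤-trans (half^-suc-≤ n) (go p≤′n)

  AbsLe-weaken : ∀ {y e e′} → AbsLe R y e → e ≤ e′ → AbsLe R y e′
  AbsLe-weaken (-e≤y , y≤e) e≤e′ = ≤-trans (neg-antimono-≤ e≤e′) -e≤y , ≤-trans y≤e e≤e′

  AbsLe-respˡ-≈ : ∀ {y y′ e} → y ≈ y′ → AbsLe R y e → AbsLe R y′ e
  AbsLe-respˡ-≈ y≈y′ (-e≤y , y≤e) = ≤-resp-≈ refl -e≤y y≈y′ , ≤-resp-≈ (sym y≈y′) y≤e refl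

  AbsLe-*-nonneg : ∀ {h t} → 0# ≤ h → AbsLe R t 1# → AbsLe R (h * t) h
  AbsLe-*-nonneg {h} {t} 0≤h (-1≤t , t≤1) = lower , upper
    where
    upper : h * t ≤ h
    upper = 0≤y-x⇒x≤y (≤-resp-≈ refl (*-nonneg 0≤h (x≤y⇒0≤y-x t≤1))
      (trans (x[y-z]≈xy-xz h 1# t) (+-congʳ (*-identityʳ h))))

    lower : - h ≤ h * t
    lower = 0≤y-x⇒x≤y (≤-resp-≈ refl (*-nonneg 0≤h (x≤y⇒0≤y-x -1≤t)) (begin
      h * (t - - 1#)      ≈⟨ x[y-z]≈xy-xz h t (- 1#) ⟩
      h * t - h * - 1#    ≈⟨ +-congˡ (-‿cong (sym (-‿distribʳ-* h 1#))) ⟩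
      h * t - - (h * 1#)  ≈⟨ +-congˡ (-‿cong (-‿cong (*-identityʳ h))) ⟩
      h * t - - h         ∎))

module DigitExpansion {c ℓ₁ ℓ₂ : Level} (R : OrderedRingWithHalf c ℓ₁ ℓ₂) where
  open OrderedRingWithHalf R
  open coI
  open NaturalSolver commutativeSemiring using (solve; _:=_; _:+_; _:*_)
  open SetoidReasoning setoid

  prefix : (n : ℕ) {x : Carrier} → coI R x → List Sd
  prefix zero    cx = []
  prefix (suc n) cx = digit cx ∷ prefix n (tail-coI cx)

  remainder : (n : ℕ) {x : Carrier} → coI R x → Carrier
  remainder zero    {x} cx = x
  remainder (suc n)     cx = remainder n (tail-coI cx)

  remainder-bound : (n : ℕ) {x : Carrier} (cx : coI R x) → AbsLe R (remainder (suc n) cx) 1#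
  remainder-bound zero    cx = tail-bound cx
  remainder-bound (suc n) cx = remainder-bound n (tail-coI cx)

  -- Generalised over the starting weight 2⁻ⁱ so that the induction goes through.
  half^-*-≈-SumFrom-prefix : (n i : ℕ) {x : Carrier} (cx : coI R x) →
    half^ R i * x ≈ SumFrom R (suc i) (prefix n cx) + half^ R i * (half^ R n * remainder n cx)
  half^-*-≈-SumFrom-prefix zero i {x} cx =
    trans (sym (+-identityˡ _)) (+-congˡ (*-congˡ (sym (*-identityˡ x))))
  half^-*-≈-SumFrom-prefix (suc n) i cx = begin
    h * _                               ≈⟨ *-congˡ (eqn cx) ⟩
    h * (½ * (d + t))                   ≈⟨ solve 4 (λ h a d t → h :* (a :* (d :+ t)) := d :* (a :* h) :+ (a :* h) :* t)
                                                   refl h ½ d t ⟩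
    d * (½ * h) + (½ * h) * t           ≈⟨ +-congˡ (half^-*-≈-SumFrom-prefix n (suc i) (tail-coI cx)) ⟩
    d * (½ * h) + (s + (½ * h) * (hₙ * r)) ≈⟨ solve 6 (λ h a d s hₙ r → d :* (a :* h) :+ (s :+ (a :* h) :* (hₙ :* r))
                                                             := d :* (a :* h) :+ s :+ h :* ((a :* hₙ) :* r))
                                                      refl h ½ d s hₙ r ⟩
    d * (½ * h) + s + h * ((½ * hₙ) * r) ∎
    where
    h  = half^ R i
    d  = ⟦_⟧ R (digit cx)
    t  = tail cx
    s  = SumFrom R (suc (suc i)) (prefix n (tail-coI cx))
    hₙ = half^ R n
    r  = remainder n (tail-coI cx)

  x-Sum-prefix≈half^-*-remainder : (n : ℕ) {x : Carrier} (cx : coI R x) →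
    x - Sum R (prefix n cx) ≈ half^ R n * remainder n cx
  x-Sum-prefix≈half^-*-remainder n {x} cx = begin
    x - s            ≈⟨ +-congʳ (trans (sym (*-identityˡ x)) (half^-*-≈-SumFrom-prefix n 0 cx)) ⟩
    s + 1# * r - s   ≈⟨ +-congʳ (+-comm s (1# * r)) ⟩
    1# * r + s - s   ≈⟨ +-assoc (1# * r) s (- s) ⟩
    1# * r + (s - s) ≈⟨ +-congˡ (-‿inverseʳ s) ⟩
    1# * r + 0#      ≈⟨ +-identityʳ (1# * r) ⟩
    1# * r           ≈⟨ *-identityˡ r ⟩
    r                ∎
    where
    s = Sum R (prefix n cx)
    r = half^ R n * remainder n cx

open OrderedRingWithHalf using (Carrier; _-_)
open import Data.Nat using (_≤_)

lemma4p8 : ∀ {c ℓ₁ ℓ₂ : Level} (R : OrderedRingWithHalf c ℓ₁ ℓ₂) →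
    (x : Carrier R) → coI R x →
    Σ (ℕ → List Sd) (λ G →
      (p : ℕ) → 1 ≤ p → (n : ℕ) → p ≤ n →
      AbsLe R (_-_ R x (Sum R (G n))) (half^ R p))
lemma4p8 R x cx = (λ n → prefix n cx) , approximation
  where
  open OrderedRingWithHalf R using (sym)
  open OrderedRingProperties R
  open DigitExpansion R

  approximation : (p : ℕ) → 1 ≤ p → (n : ℕ) → p ≤ n →
                  AbsLe R (_-_ R x (Sum R (prefix n cx))) (half^ R p)
  approximation (suc p) _ (suc n) p≤n =
    AbsLe-respˡ-≈ (sym (x-Sum-prefix≈half^-*-remainder (suc n) cx))
      (AbsLe-weaken (AbsLe-*-nonneg (half^-nonneg (suc n)) (remainder-bound n cx))
                    (half^-antitone p≤n))
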